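{- For any connected graph $G$, $\mathsf{mtw}(G) \le \mathsf{mtd}(G) + 1$.
   Context: An elimination tree of a connected graph $G$ is a rooted tree $(T,r)$ with $r\in V(G)$ whose root-subtrees are, recursively, elimination trees of the connected components of $G - r$; its depth is the maximum number of vertices on a root-to-leaf path. A matched elimination tree is one in which for every root-to-leaf path $(v_1,\dots,v_k)$: if $k$ is even, $v_1v_2,\dots,v_{k-1}v_k$ are edges of $G$; if $k$ is odd, the sequence splits into consecutive blocks, all of size 2 except exactly one of size 3, each size-2 block $(v_j,v_{j+1})$ having $v_jv_{j+1}\in E(G)$ and the size-3 block $(v_j,v_{j+1},v_{j+2})$ having $v_jv_{j+1},v_{j+1}v_{j+2}\in E(G)$; $\mathsf{mtd}(G)$ is the minimum depth of a matched elimination tree. A tree decomposition has bags covering every edge with each vertex's bags forming a nonempty connected subtree; width is maximum bag size minus one. A bag is matched if the subgraph induced by it has a perfect matching, or a matching leaving exactly one vertex $v$ unmatched with $v$ adjacent to a matched vertex. $\mathsf{mtw}(G)$ is the minimum width of a tree decomposition all of whose bags are matched. -}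

module Defs where

open import Data.Nat using (ℕ; zero; suc; _⊔_; _∸_; _≤_)
open import Data.Fin using (Fin)
open import Data.Fin.Subset using (Subset; ∣_∣) renaming (_∈_ to _∈ₛ_)
open import Data.List using (List; []; _∷_; length; lookup; concatMap)
open import Data.List.Relation.Unary.Any using (Any)
open import Data.List.Relation.Unary.All using (All)
open import Data.List.Relation.Unary.Unique.Propositional using (Unique)
open import Data.List.Membership.Propositional using () renaming (_∈_ to _∈ₗ_)
open import Data.Product using (Σ; _×_; _,_; ∃)
open import Data.Sum using (_⊎_)
open import Data.Unit using (⊤)
open import Relation.Nullary using (¬_)
open import Relation.Binary.PropositionalEquality using (_≡_; _≢_)

record Graph (n : ℕ) : Set₁ where
  field
    Adj    : Fin n → Fin n → Set
    sym    : ∀ {u v} → Adj u v → Adj v u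
    irrefl : ∀ {u} → ¬ Adj u u
open Graph public

VSet : ℕ → Set₁
VSet n = Fin n → Set

data Walk {n} (G : Graph n) (S : VSet n) : Fin n → Fin n → Set where
  stay : ∀ {u} → S u → Walk G S u u
  step : ∀ {u w v} → S u → Adj G u w → Walk G S w v → Walk G S u v

Connected : ∀ {n} → Graph n → VSet n → Set
Connected G S = ∀ u v → S u → S v → Walk G S u v

ConnectedGraph : ∀ {n} → Graph n → Set
ConnectedGraph G = Connected G (λ _ → ⊤)

data Tree (A : Set) : Set where
  node : A → List (Tree A) → Tree A

data _∈T_ {n} (v : Fin n) : Tree (Fin n) → Set where
  root  : ∀ {cs} → v ∈T node v cs
  below : ∀ {r cs} → Any (v ∈T_) cs → v ∈T node r cs

-- (T,r) is an elimination tree of the connected graph G[V(T)]: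
-- G[V(T)] is connected, r is the root, the vertex sets of the
-- root-subtrees are exactly the connected components of G[V(T)] - r
-- (they avoid r, cover V(T) - r by construction, are pairwise disjoint,
-- have no edges between them, and are connected), and recursively each
-- root-subtree is an elimination tree of its component.
data IsElim {n} (G : Graph n) : Tree (Fin n) → Set where
  elim : ∀ {r cs} →
         Connected G (_∈T node r cs) →
         All (IsElim G) cs →
         All (λ c → ¬ (r ∈T c)) cs →
         (∀ (i j : Fin (length cs)) → i ≢ j → ∀ u v →
            u ∈T lookup cs i → v ∈T lookup cs j → (u ≢ v) × ¬ Adj G u v) →
         IsElim G (node r cs)

ElimTreeOf : ∀ {n} → Graph n → Tree (Fin n) → Set
ElimTreeOf G t = IsElim G t × (∀ v → v ∈T t)

-- depth = maximum number of vertices on a root-to-leaf path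
mutual
  depth : ∀ {A} → Tree A → ℕ
  depth (node _ cs) = suc (depths cs)

  depths : ∀ {A} → List (Tree A) → ℕ
  depths []       = 0
  depths (c ∷ cs) = depth c ⊔ depths cs

data RootLeaf {A : Set} : Tree A → List A → Set where
  leaf : ∀ {r} → RootLeaf (node r []) (r ∷ [])
  down : ∀ {r cs p} → Any (λ c → RootLeaf c p) cs → RootLeaf (node r cs) (r ∷ p)

data EvenPaired {n} (G : Graph n) : List (Fin n) → Set where
  []  : EvenPaired G []
  pair : ∀ {a b p} → Adj G a b → EvenPaired G p → EvenPaired G (a ∷ b ∷ p)

data OddPaired {n} (G : Graph n) : List (Fin n) → Set where
  pair   : ∀ {a b p} → Adj G a b → OddPaired G p → OddPaired G (a ∷ b ∷ p)
  triple : ∀ {a b c p} → Adj G a b → Adj G b c → EvenPaired G p →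
           OddPaired G (a ∷ b ∷ c ∷ p)

MatchedSeq : ∀ {n} → Graph n → List (Fin n) → Set
MatchedSeq G p = EvenPaired G p ⊎ OddPaired G p

MatchedElim : ∀ {n} → Graph n → Tree (Fin n) → Set
MatchedElim G t = ∀ p → RootLeaf t p → MatchedSeq G p

IsMTD : ∀ {n} → Graph n → ℕ → Set
IsMTD G d =
  (Σ (Tree (Fin _)) λ t → ElimTreeOf G t × MatchedElim G t × depth t ≡ d) ×
  (∀ t → ElimTreeOf G t → MatchedElim G t → d ≤ depth t)

data Pos {A : Set} : Tree A → Set where
  here  : ∀ {t} → Pos t
  child : ∀ {x cs} (i : Fin (length cs)) → Pos (lookup cs i) → Pos (node x cs)

label : ∀ {A} {t : Tree A} → Pos t → A
label {t = node x cs} here        = x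
label {t = node x cs} (child i p) = label p

data TAdj {A : Set} : {t : Tree A} → Pos t → Pos t → Set where
  down   : ∀ {x cs} (i : Fin (length cs)) →
           TAdj {t = node x cs} here (child i here)
  up     : ∀ {x cs} (i : Fin (length cs)) →
           TAdj {t = node x cs} (child i here) here
  inside : ∀ {x cs} (i : Fin (length cs)) {p q : Pos (lookup cs i)} →
           TAdj p q → TAdj {t = node x cs} (child i p) (child i q)

data TWalk {A : Set} {t : Tree A} (S : Pos t → Set) : Pos t → Pos t → Set where
  stay : ∀ {p} → S p → TWalk S p p
  step : ∀ {p q r} → S p → TAdj p q → TWalk S q r → TWalk S p r

module _ {n : ℕ} where
  Bag : Set
  Bag = Subset n

  IsTD : Graph n → Tree Bag → Set
  IsTD G T =
    (∀ u v → Adj G u v → Σ (Pos T) λ p → (u ∈ₛ label p) × (v ∈ₛ label p)) ×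
    (∀ v → Σ (Pos T) (λ p → v ∈ₛ label p)) ×
    (∀ v (p q : Pos T) → v ∈ₛ label p → v ∈ₛ label q →
       TWalk (λ s → v ∈ₛ label s) p q)

mutual
  maxBag : ∀ {n} → Tree (Subset n) → ℕ
  maxBag (node B cs) = ∣ B ∣ ⊔ maxBags cs

  maxBags : ∀ {n} → List (Tree (Subset n)) → ℕ
  maxBags []       = 0
  maxBags (c ∷ cs) = maxBag c ⊔ maxBags cs

width : ∀ {n} → Tree (Subset n) → ℕ
width T = maxBag T ∸ 1

endpoints : ∀ {n} → List (Fin n × Fin n) → List (Fin n)
endpoints = concatMap (λ { (u , v) → u ∷ v ∷ [] })

IsMatchingIn : ∀ {n} → Graph n → Subset n → List (Fin n × Fin n) → Set
IsMatchingIn G B M =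
  All (λ { (u , v) → Adj G u v × (u ∈ₛ B) × (v ∈ₛ B) }) M × Unique (endpoints M)

Covered : ∀ {n} → List (Fin n × Fin n) → Fin n → Set
Covered M x = x ∈ₗ endpoints M

MatchedBag : ∀ {n} → Graph n → Subset n → Set
MatchedBag G B = Σ (List (Fin _ × Fin _)) λ M → IsMatchingIn G B M ×
  ((∀ x → x ∈ₛ B → Covered M x) ⊎
   (Σ (Fin _) λ v → (v ∈ₛ B) × ¬ Covered M v ×
      (∀ x → x ∈ₛ B → x ≢ v → Covered M x) ×
      (Σ (Fin _) λ w → Covered M w × Adj G v w)))

MatchedTD : ∀ {n} → Graph n → Tree (Subset n) → Set
MatchedTD G T = IsTD G T × (∀ (p : Pos T) → MatchedBag G (label p))

MTW≤ : ∀ {n} → Graph n → ℕ → Set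
MTW≤ G k = Σ (Tree (Subset _)) λ T → MatchedTD G T × width T ≤ k

-- Let T be a matched elimination tree of depth d. Give the tree decomposition
-- the shape of T, and let the bag of a node v consist of the ancestors of v
-- followed by the leftmost downward path from v to a leaf. Every bag is then
-- the vertex set of a root-to-leaf path of T, hence has at most d vertices and
-- is matched by the blocks of that path. A vertex x lies in the bags of the
-- subtree rooted at x and of a chain of nodes leading up from x, so its bags
-- are connected; an edge joins a vertex to one of its ancestors (distinct
-- root-subtrees of T have no edges between them), so it lies in the bag of
-- its lower end.
module Submission where

open import Defs
open import Data.Nat using (ℕ; _+_; _∸_; _≤_; z≤n; s≤s)
open import Data.Nat.Properties
  using (≤-trans; ≤-reflexive; module ≤-Reasoning; +-suc; +-mono-≤; +-monoʳ-≤; n≤1+n;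
         m≤m⊔n; m≤n⊔m; ⊔-lub; m∸n≤m; m≤m+n)
open import Data.Fin using (Fin; zero; suc)
open import Data.Fin.Properties using (_≟_; suc-injective)
open import Data.Fin.Subset using (Subset; ∣_∣; ⊥; ⁅_⁆; _∪_; inside; outside) renaming (_∈_ to _∈ₛ_)
open import Data.Fin.Subset.Properties using (∉⊥; ∣⊥∣≡0; ∣⁅x⁆∣≡1; x∈⁅x⁆; x∈⁅y⁆⇒x≡y; x∈p∪q⁺; x∈p∪q⁻)
open import Data.Vec using ([]; _∷_)
open import Data.List using (List; []; _∷_; _++_; [_]; length; lookup)
open import Data.List.Properties using (++-assoc)
open import Data.List.Membership.Propositional using (_∈_)
open import Data.List.Membership.Propositional.Properties using (∈-++⁺ˡ; ∈-++⁺ʳ; ∈-++⁻)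
open import Data.List.Relation.Unary.Any using (Any; here; there; index)
import Data.List.Relation.Unary.Any as Any
open import Data.List.Relation.Unary.Any.Properties using (lookup-index)
open import Data.List.Relation.Unary.All using (All; []; _∷_)
import Data.List.Relation.Unary.All as All
open import Data.List.Relation.Unary.AllPairs using ([]; _∷_)
open import Data.List.Relation.Unary.Unique.Propositional using (Unique)
open import Data.List.Relation.Binary.Permutation.Propositional
  using (_↭_; ↭-prep; ↭-trans; ↭-sym; ↭⇒↭ₛ)
open import Data.List.Relation.Binary.Permutation.Propositional.Properties using (∈-resp-↭; shift)
import Data.List.Relation.Binary.Permutation.Setoid.Properties as SetoidPermutation
open import Data.Product using (Σ; _×_; _,_; proj₁; proj₂; map₂; swap; uncurry)
open import Data.Sum using (_⊎_; inj₁; inj₂)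
open import Data.Empty using (⊥-elim)
open import Relation.Nullary using (¬_; yes; no)
open import Relation.Binary.PropositionalEquality using (_≡_; _≢_; refl; cong; subst; setoid)
  renaming (sym to ≡-sym)

fromList : ∀ {n} → List (Fin n) → Subset n
fromList []       = ⊥
fromList (x ∷ xs) = ⁅ x ⁆ ∪ fromList xs

∈-fromList⁺ : ∀ {n} {x : Fin n} {xs} → x ∈ xs → x ∈ₛ fromList xs
∈-fromList⁺ {xs = y ∷ _} (here refl) = x∈p∪q⁺ (inj₁ (x∈⁅x⁆ y))
∈-fromList⁺ (there x∈xs)            = x∈p∪q⁺ (inj₂ (∈-fromList⁺ x∈xs))

∈-fromList⁻ : ∀ {n} {x : Fin n} xs → x ∈ₛ fromList xs → x ∈ xs
∈-fromList⁻ []       x∈ = ⊥-elim (∉⊥ x∈)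
∈-fromList⁻ (y ∷ xs) x∈ with x∈p∪q⁻ ⁅ y ⁆ (fromList xs) x∈
... | inj₁ x∈y  = here (x∈⁅y⁆⇒x≡y y x∈y)
... | inj₂ x∈xs = there (∈-fromList⁻ xs x∈xs)

∣p∪q∣≤∣p∣+∣q∣ : ∀ {n} (p q : Subset n) → ∣ p ∪ q ∣ ≤ ∣ p ∣ + ∣ q ∣
∣p∪q∣≤∣p∣+∣q∣ []            []            = z≤n
∣p∪q∣≤∣p∣+∣q∣ (outside ∷ p) (outside ∷ q) = ∣p∪q∣≤∣p∣+∣q∣ p q
∣p∪q∣≤∣p∣+∣q∣ (outside ∷ p) (inside ∷ q)  =
  ≤-trans (s≤s (∣p∪q∣≤∣p∣+∣q∣ p q)) (≤-reflexive (≡-sym (+-suc ∣ p ∣ ∣ q ∣)))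
∣p∪q∣≤∣p∣+∣q∣ (inside ∷ p)  (outside ∷ q) = s≤s (∣p∪q∣≤∣p∣+∣q∣ p q)
∣p∪q∣≤∣p∣+∣q∣ (inside ∷ p)  (inside ∷ q)  =
  s≤s (≤-trans (∣p∪q∣≤∣p∣+∣q∣ p q) (+-monoʳ-≤ ∣ p ∣ (n≤1+n ∣ q ∣)))

∣fromList∣≤length : ∀ {n} (xs : List (Fin n)) → ∣ fromList xs ∣ ≤ length xs
∣fromList∣≤length {n} []  = ≤-reflexive (∣⊥∣≡0 n)
∣fromList∣≤length (x ∷ xs) =
  ≤-trans (∣p∪q∣≤∣p∣+∣q∣ ⁅ x ⁆ (fromList xs))
          (+-mono-≤ (≤-reflexive (∣⁅x⁆∣≡1 x)) (∣fromList∣≤length xs))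

module _ {A : Set} where

  TAdj-sym : ∀ {t : Tree A} {p q : Pos t} → TAdj p q → TAdj q p
  TAdj-sym (down i)     = up i
  TAdj-sym (up i)       = down i
  TAdj-sym (inside i a) = inside i (TAdj-sym a)

  module _ {t : Tree A} {S : Pos t → Set} where

    TWalk-start : ∀ {p q} → TWalk S p q → S p
    TWalk-start (stay s)     = s
    TWalk-start (step s _ _) = s

    TWalk-end : ∀ {p q} → TWalk S p q → S q
    TWalk-end (stay s)     = s
    TWalk-end (step _ _ w) = TWalk-end w

    infixr 5 _++ʷ_
    _++ʷ_ : ∀ {p q r} → TWalk S p q → TWalk S q r → TWalk S p r
    stay _     ++ʷ w′ = w′
    step s a w ++ʷ w′ = step s a (w ++ʷ w′)

    TWalk-reverse : ∀ {p q} → TWalk S p q → TWalk S q p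
    TWalk-reverse (stay s)     = stay s
    TWalk-reverse (step s a w) = TWalk-reverse w ++ʷ step (TWalk-start w) (TAdj-sym a) (stay s)

  TWalk-child : ∀ {x : A} {cs} (i : Fin (length cs)) {S : Pos (node x cs) → Set} {p q} →
                TWalk (λ u → S (child i u)) p q → TWalk S (child i p) (child i q)
  TWalk-child i (stay s)     = stay s
  TWalk-child i (step s a w) = step s (inside i a) (TWalk-child i w)

module _ {A : Set} where

  mutual
    leftmostBranch : Tree A → List A
    leftmostBranch (node r cs) = r ∷ leftmostBranch* cs

    leftmostBranch* : List (Tree A) → List A
    leftmostBranch* []      = []
    leftmostBranch* (c ∷ _) = leftmostBranch c

  RootLeaf-leftmostBranch : ∀ t → RootLeaf t (leftmostBranch t)
  RootLeaf-leftmostBranch (node r [])      = leaf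
  RootLeaf-leftmostBranch (node r (c ∷ _)) = down (here (RootLeaf-leftmostBranch c))

  mutual
    length≤depth : ∀ {t : Tree A} {L} → RootLeaf t L → length L ≤ depth t
    length≤depth leaf     = s≤s z≤n
    length≤depth (down h) = s≤s (length≤depths h)

    length≤depths : ∀ {cs : List (Tree A)} {L} → Any (λ c → RootLeaf c L) cs → length L ≤ depths cs
    length≤depths (here rl) = ≤-trans (length≤depth rl) (m≤m⊔n _ _)
    length≤depths (there h) = ≤-trans (length≤depths h) (m≤n⊔m _ _)

mutual
  maxBag≤ : ∀ {n} (T : Tree (Subset n)) {k} → (∀ (p : Pos T) → ∣ label p ∣ ≤ k) → maxBag T ≤ k
  maxBag≤ (node B cs) bound = ⊔-lub (bound here) (maxBags≤ cs (λ i p → bound (child i p)))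

  maxBags≤ : ∀ {n} (cs : List (Tree (Subset n))) {k} →
             (∀ i (p : Pos (lookup cs i)) → ∣ label p ∣ ≤ k) → maxBags cs ≤ k
  maxBags≤ []       bound = z≤n
  maxBags≤ (c ∷ cs) bound = ⊔-lub (maxBag≤ c (bound zero)) (maxBags≤ cs (λ i → bound (suc i)))

module _ {n : ℕ} (G : Graph n) where

  open SetoidPermutation (setoid (Fin n)) using (Unique-resp-↭)

  even-matching : ∀ {p} → EvenPaired G p →
                  Σ (List (Fin n × Fin n)) λ M → All (uncurry (Adj G)) M × endpoints M ≡ p
  even-matching []                  = [] , [] , refl
  even-matching (pair {a} {b} ab e) with even-matching e
  ... | M , edges , refl = (a , b) ∷ M , ab ∷ edges , refl

  record AlmostPerfect (p : List (Fin n)) : Set where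
    field
      pairs           : List (Fin n × Fin n)
      edges           : All (uncurry (Adj G)) pairs
      spare partner   : Fin n
      spare-first     : p ↭ spare ∷ endpoints pairs
      partner-matched : partner ∈ endpoints pairs
      spare-partner   : Adj G spare partner

  odd-matching : ∀ {p} → OddPaired G p → AlmostPerfect p
  odd-matching (triple {a} {b} {c} ab bc e) with even-matching e
  ... | M , edges , refl = record
    { pairs           = (a , b) ∷ M
    ; edges           = ab ∷ edges
    ; spare           = c
    ; partner         = b
    ; spare-first     = shift c (a ∷ b ∷ []) (endpoints M)
    ; partner-matched = there (here refl)
    ; spare-partner   = sym G bc
    }
  odd-matching (pair {a} {b} ab o) = record
    { pairs           = (a , b) ∷ pairs
    ; edges           = ab ∷ edges
    ; spare           = spare
    ; partner         = partner
    ; spare-first     = ↭-trans (↭-prep a (↭-prep b spare-first))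
                                (shift spare (a ∷ b ∷ []) (endpoints pairs))
    ; partner-matched = there (there partner-matched)
    ; spare-partner   = spare-partner
    }
    where open AlmostPerfect (odd-matching o)

  matching-in : ∀ {B} M → All (uncurry (Adj G)) M → (∀ {x} → x ∈ endpoints M → x ∈ₛ B) →
                Unique (endpoints M) → IsMatchingIn G B M
  matching-in []            []           ⊆B U               = [] , U
  matching-in ((u , v) ∷ M) (uv ∷ edges) ⊆B U@(_ ∷ _ ∷ U′) =
    (uv , ⊆B (here refl) , ⊆B (there (here refl)))
    ∷ proj₁ (matching-in M edges (λ x∈ → ⊆B (there (there x∈))) U′) , U

  almostPerfect-matched : ∀ {p} → Unique p → AlmostPerfect p → MatchedBag G (fromList p)
  almostPerfect-matched {p} U m with Unique-resp-↭ (↭⇒↭ₛ (AlmostPerfect.spare-first m)) U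
  ... | spare∉ ∷ U′ =
    pairs ,
    matching-in pairs edges (λ x∈ → ∈-fromList⁺ (∈-resp-↭ (↭-sym spare-first) (there x∈))) U′ ,
    inj₂ (spare , ∈-fromList⁺ (∈-resp-↭ (↭-sym spare-first) (here refl)) ,
          (λ spare∈ → All.lookup spare∉ spare∈ refl) , covered ,
          partner , partner-matched , spare-partner)
    where
      open AlmostPerfect m
      covered : ∀ x → x ∈ₛ fromList p → x ≢ spare → x ∈ endpoints pairs
      covered x x∈ x≢spare with ∈-resp-↭ spare-first (∈-fromList⁻ p x∈)
      ... | here x≡spare = ⊥-elim (x≢spare x≡spare)
      ... | there x∈M    = x∈M

  fromList-matched : ∀ {p} → Unique p → MatchedSeq G p → MatchedBag G (fromList p)
  fromList-matched U (inj₁ e) with even-matching e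
  ... | M , edges , refl =
    M , matching-in M edges ∈-fromList⁺ U , inj₁ (λ x x∈ → ∈-fromList⁻ _ x∈)
  fromList-matched U (inj₂ o) = almostPerfect-matched U (odd-matching o)

module _ {n : ℕ} where

  mutual
    ∈-branch⇒∈T : ∀ {t L} {x : Fin n} → RootLeaf t L → x ∈ L → x ∈T t
    ∈-branch⇒∈T leaf     (here refl)  = root
    ∈-branch⇒∈T (down h) (here refl)  = root
    ∈-branch⇒∈T (down h) (there x∈L) = below (∈-branch⇒∈T* h x∈L)

    ∈-branch⇒∈T* : ∀ {cs L} {x : Fin n} → Any (λ c → RootLeaf c L) cs → x ∈ L → Any (x ∈T_) cs
    ∈-branch⇒∈T* (here rl) x∈L = here (∈-branch⇒∈T rl x∈L)
    ∈-branch⇒∈T* (there h) x∈L = there (∈-branch⇒∈T* h x∈L)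

  -- The argument a lists the strict ancestors of the current node, root first.
  mutual
    branchTD : List (Fin n) → Tree (Fin n) → Tree (Subset n)
    branchTD a t@(node r cs) = node (fromList (a ++ leftmostBranch t)) (branchTDs (a ++ [ r ]) cs)

    branchTDs : List (Fin n) → List (Tree (Fin n)) → List (Tree (Subset n))
    branchTDs a []       = []
    branchTDs a (c ∷ cs) = branchTD a c ∷ branchTDs a cs

  _∈bag_ : ∀ {T : Tree (Subset n)} → Fin n → Pos T → Set
  x ∈bag p = x ∈ₛ label p

  mutual
    bag-branch : ∀ a t (p : Pos (branchTD a t)) →
                 Σ (List (Fin n)) λ L → label p ≡ fromList (a ++ L) × RootLeaf t L
    bag-branch a t@(node r cs) here = leftmostBranch t , refl , RootLeaf-leftmostBranch t
    bag-branch a (node r cs) (child i p) with bag-branch* (a ++ [ r ]) cs i p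
    ... | L , bag≡ , h =
      r ∷ L , subst (λ b → label p ≡ fromList b) (++-assoc a [ r ] L) bag≡ , down h

    bag-branch* : ∀ a cs (i : Fin (length (branchTDs a cs))) (p : Pos (lookup (branchTDs a cs) i)) →
                  Σ (List (Fin n)) λ L → label p ≡ fromList (a ++ L) × Any (λ c → RootLeaf c L) cs
    bag-branch* a (c ∷ cs) zero p with bag-branch a c p
    ... | L , bag≡ , rl = L , bag≡ , here rl
    bag-branch* a (c ∷ cs) (suc i) p with bag-branch* a cs i p
    ... | L , bag≡ , h = L , bag≡ , there h

  ∈bag∖prefix⇒∈T : ∀ {x} a t (p : Pos (branchTD a t)) → ¬ x ∈ a → x ∈bag p → x ∈T t
  ∈bag∖prefix⇒∈T {x} a t p x∉a x∈p with bag-branch a t p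
  ... | L , bag≡ , rl with ∈-++⁻ a (∈-fromList⁻ (a ++ L) (subst (x ∈ₛ_) bag≡ x∈p))
  ...   | inj₁ x∈a = ⊥-elim (x∉a x∈a)
  ...   | inj₂ x∈L = ∈-branch⇒∈T rl x∈L

  ∈bag∖prefix⇒∈T* : ∀ {x} a cs (i : Fin (length (branchTDs a cs)))
                    (p : Pos (lookup (branchTDs a cs) i)) → ¬ x ∈ a → x ∈bag p → Any (x ∈T_) cs
  ∈bag∖prefix⇒∈T* a (c ∷ cs) zero    p x∉a x∈p = here (∈bag∖prefix⇒∈T a c p x∉a x∈p)
  ∈bag∖prefix⇒∈T* a (c ∷ cs) (suc i) p x∉a x∈p = there (∈bag∖prefix⇒∈T* a cs i p x∉a x∈p)

  ∈-rootBag⁺ : ∀ {x} (a : List (Fin n)) r L → x ∈ a ++ [ r ] → x ∈ₛ fromList (a ++ r ∷ L)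
  ∈-rootBag⁺ a r L x∈ = ∈-fromList⁺ (subst (_ ∈_) (++-assoc a [ r ] L) (∈-++⁺ˡ x∈))

  ∈-rootBag⁻ : ∀ {x} (a : List (Fin n)) r L → x ∈ₛ fromList (a ++ r ∷ L) → x ∈ a ++ [ r ] ⊎ x ∈ L
  ∈-rootBag⁻ a r L x∈ =
    ∈-++⁻ (a ++ [ r ]) (subst (_ ∈_) (≡-sym (++-assoc a [ r ] L)) (∈-fromList⁻ _ x∈))

  ∈-leftmostBranch⇒∈bag : ∀ {x} a t → x ∈ leftmostBranch t → x ∈bag here {t = branchTD a t}
  ∈-leftmostBranch⇒∈bag a (node r cs) x∈ = ∈-fromList⁺ (∈-++⁺ʳ a x∈)

  -- Apart from the ancestors, the root bag holds the leftmost branch, which enters the first child.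
  rootBag⇒firstChildBag : ∀ {x} (a : List (Fin n)) r c → ¬ x ∈ a ++ [ r ] →
                          x ∈ₛ fromList (a ++ r ∷ leftmostBranch c) →
                          x ∈bag here {t = branchTD (a ++ [ r ]) c}
  rootBag⇒firstChildBag a r c x∉ x∈r with ∈-rootBag⁻ a r (leftmostBranch c) x∈r
  ... | inj₁ x∈  = ⊥-elim (x∉ x∈)
  ... | inj₂ x∈c = ∈-leftmostBranch⇒∈bag (a ++ [ r ]) c x∈c

  module _ (P : Subset n → Set) where

    child-of : ∀ {a cs} → Any (λ c → Σ (Pos (branchTD a c)) λ p → P (label p)) cs →
               Σ (Fin (length (branchTDs a cs))) λ i →
               Σ (Pos (lookup (branchTDs a cs) i)) λ p → P (label p)
    child-of (here (p , Pp)) = zero , p , Pp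
    child-of (there h) with child-of h
    ... | i , p , Pp = suc i , p , Pp

    at-child : ∀ {a r cs} → Any (λ c → Σ (Pos (branchTD (a ++ [ r ]) c)) λ p → P (label p)) cs →
               Σ (Pos (branchTD a (node r cs))) λ p → P (label p)
    at-child h with child-of h
    ... | i , p , Pp = child i p , Pp

  mutual
    vertex-covered : ∀ {x} a t → x ∈T t → Σ (Pos (branchTD a t)) (x ∈bag_)
    vertex-covered a (node r cs) root      = here , ∈-rootBag⁺ a r _ (∈-++⁺ʳ a (here refl))
    vertex-covered a (node r cs) (below h) = at-child (_ ∈ₛ_) (vertex-covered* (a ++ [ r ]) cs h)

    vertex-covered* : ∀ {x} a cs → Any (x ∈T_) cs → Any (λ c → Σ (Pos (branchTD a c)) (x ∈bag_)) cs
    vertex-covered* a (c ∷ cs) (here x∈c) = here (vertex-covered a c x∈c)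
    vertex-covered* a (c ∷ cs) (there h)  = there (vertex-covered* a cs h)

  mutual
    walk-to-root : ∀ {x} a r cs → x ∈ a ++ [ r ] → (p : Pos (branchTD a (node r cs))) →
                   TWalk (x ∈bag_) p here
    walk-to-root a r cs x∈ here        = stay (∈-rootBag⁺ a r _ x∈)
    walk-to-root {x} a r cs x∈ (child i p) =
      w ++ʷ step (TWalk-end w) (up i) (stay (∈-rootBag⁺ a r _ x∈))
      where
        w : TWalk (x ∈bag_) (child i p) (child i here)
        w = TWalk-child i (walk-to-root* (a ++ [ r ]) cs x∈ i p)

    walk-to-root* : ∀ {x} a cs → x ∈ a → (i : Fin (length (branchTDs a cs)))
                    (p : Pos (lookup (branchTDs a cs) i)) → TWalk (x ∈bag_) p here
    walk-to-root* a (node r cs ∷ _) x∈a zero    p = walk-to-root a r cs (∈-++⁺ˡ x∈a) p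
    walk-to-root* a (_ ∷ cs)        x∈a (suc i) p = walk-to-root* a cs x∈a i p

module _ {n : ℕ} (G : Graph n) where

  open import Data.List.Membership.DecPropositional (_≟_ {n}) using (_∈?_)

  Separated : List (Tree (Fin n)) → Set
  Separated cs = ∀ (i j : Fin (length cs)) → i ≢ j → ∀ u v →
                 u ∈T lookup cs i → v ∈T lookup cs j → (u ≢ v) × ¬ Adj G u v

  separated-tail : ∀ {c cs} → Separated (c ∷ cs) → Separated cs
  separated-tail sep i j i≢j = sep (suc i) (suc j) (λ eq → i≢j (suc-injective eq))

  separated-head : ∀ {c cs u v} → Separated (c ∷ cs) → u ∈T c → Any (v ∈T_) cs →
                   (u ≢ v) × ¬ Adj G u v
  separated-head sep u∈c v∈cs = sep zero (suc (index v∈cs)) (λ ()) _ _ u∈c (lookup-index v∈cs)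

  adjacent-same-child : ∀ {cs u v} → Separated cs → Adj G u v → Any (u ∈T_) cs → Any (v ∈T_) cs →
                        Any (λ c → u ∈T c × v ∈T c) cs
  adjacent-same-child sep uv (here u∈c)   (here v∈c)   = here (u∈c , v∈c)
  adjacent-same-child sep uv (here u∈c)   (there v∈cs) =
    ⊥-elim (proj₂ (separated-head sep u∈c v∈cs) uv)
  adjacent-same-child sep uv (there u∈cs) (here v∈c)   =
    ⊥-elim (proj₂ (separated-head sep v∈c u∈cs) (sym G uv))
  adjacent-same-child sep uv (there u∈cs) (there v∈cs) =
    there (adjacent-same-child (separated-tail sep) uv u∈cs v∈cs)

  same-child : ∀ {x} a cs → Separated cs → ¬ x ∈ a →
               (i j : Fin (length (branchTDs a cs)))
               (p : Pos (lookup (branchTDs a cs) i)) (q : Pos (lookup (branchTDs a cs) j)) →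
               x ∈bag p → x ∈bag q → i ≡ j
  same-child a (c ∷ cs) sep x∉a zero    zero    p q x∈p x∈q = refl
  same-child a (c ∷ cs) sep x∉a zero    (suc j) p q x∈p x∈q =
    ⊥-elim (proj₁ (separated-head sep (∈bag∖prefix⇒∈T a c p x∉a x∈p)
                                      (∈bag∖prefix⇒∈T* a cs j q x∉a x∈q)) refl)
  same-child a (c ∷ cs) sep x∉a (suc i) zero    p q x∈p x∈q =
    ⊥-elim (proj₁ (separated-head sep (∈bag∖prefix⇒∈T a c q x∉a x∈q)
                                      (∈bag∖prefix⇒∈T* a cs i p x∉a x∈p)) refl)
  same-child a (c ∷ cs) sep x∉a (suc i) (suc j) p q x∈p x∈q =
    cong suc (same-child a cs (separated-tail sep) x∉a i j p q x∈p x∈q)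

  mutual
    bags-connected : ∀ {x} a t → IsElim G t → (p q : Pos (branchTD a t)) →
                     x ∈bag p → x ∈bag q → TWalk (x ∈bag_) p q
    bags-connected {x} a (node r cs) e p q x∈p x∈q with x ∈? a ++ [ r ]
    ... | yes x∈ = walk-to-root a r cs x∈ p ++ʷ TWalk-reverse (walk-to-root a r cs x∈ q)
    ... | no x∉  = bags-connected-below a r cs e x∉ p q x∈p x∈q

    bags-connected-below : ∀ {x} a r cs → IsElim G (node r cs) → ¬ x ∈ a ++ [ r ] →
                           (p q : Pos (branchTD a (node r cs))) →
                           x ∈bag p → x ∈bag q → TWalk (x ∈bag_) p q
    bags-connected-below a r cs e x∉ here        here        x∈p x∈q = stay x∈p
    bags-connected-below a r cs e x∉ here        (child j q) x∈p x∈q =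
      root-to-child a r cs e x∉ j q x∈p x∈q
    bags-connected-below a r cs e x∉ (child i p) here        x∈p x∈q =
      TWalk-reverse (root-to-child a r cs e x∉ i p x∈q x∈p)
    bags-connected-below a r cs e x∉ (child i p) (child j q) x∈p x∈q =
      within-child a r cs e x∉ i j p q x∈p x∈q

    root-to-child : ∀ {x} a r cs → IsElim G (node r cs) → ¬ x ∈ a ++ [ r ] →
                    (j : Fin (length (branchTDs (a ++ [ r ]) cs)))
                    (q : Pos (lookup (branchTDs (a ++ [ r ]) cs) j)) →
                    x ∈bag here {t = branchTD a (node r cs)} → x ∈bag q →
                    TWalk (x ∈bag_) here (child j q)
    root-to-child a r []       e x∉ () q x∈r x∈q
    root-to-child a r (c ∷ cs) e x∉ j  q x∈r x∈q =
      step x∈r (down zero)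
        (within-child a r (c ∷ cs) e x∉ zero j here q (rootBag⇒firstChildBag a r c x∉ x∈r) x∈q)

    within-child : ∀ {x} a r cs → IsElim G (node r cs) → ¬ x ∈ a ++ [ r ] →
                   (i j : Fin (length (branchTDs (a ++ [ r ]) cs)))
                   (p : Pos (lookup (branchTDs (a ++ [ r ]) cs) i))
                   (q : Pos (lookup (branchTDs (a ++ [ r ]) cs) j)) → x ∈bag p → x ∈bag q →
                   TWalk {t = branchTD a (node r cs)} (x ∈bag_) (child i p) (child j q)
    within-child a r cs (elim _ es _ sep) x∉ i j p q x∈p x∈q
      with same-child (a ++ [ r ]) cs sep x∉ i j p q x∈p x∈q
    ... | refl = TWalk-child i (bags-connected* (a ++ [ r ]) cs es i p q x∈p x∈q)

    bags-connected* : ∀ {x} a cs → All (IsElim G) cs → (i : Fin (length (branchTDs a cs)))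
                      (p q : Pos (lookup (branchTDs a cs) i)) →
                      x ∈bag p → x ∈bag q → TWalk (x ∈bag_) p q
    bags-connected* a (c ∷ cs) (e ∷ es) zero    p q x∈p x∈q = bags-connected a c e p q x∈p x∈q
    bags-connected* a (c ∷ cs) (e ∷ es) (suc i) p q x∈p x∈q =
      bags-connected* a cs es i p q x∈p x∈q

  mutual
    edge-covered : ∀ {u v} a t → IsElim G t → Adj G u v → u ∈T t → v ∈ a ⊎ v ∈T t →
                   Σ (Pos (branchTD a t)) λ p → u ∈bag p × v ∈bag p
    edge-covered a (node r cs) e uv root (inj₁ v∈a) =
      here , ∈-rootBag⁺ a r _ (∈-++⁺ʳ a (here refl)) , ∈-rootBag⁺ a r _ (∈-++⁺ˡ v∈a)
    edge-covered a (node r cs) e uv root (inj₂ root) = ⊥-elim (irrefl G uv)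
    edge-covered a (node r cs) (elim _ es _ _) uv root (inj₂ (below v∈cs)) =
      map₂ swap (at-child (λ B → _ ∈ₛ B × _ ∈ₛ B)
        (edge-covered* (a ++ [ r ]) cs es (sym G uv)
          (Any.map (λ v∈c → v∈c , inj₁ (∈-++⁺ʳ a (here refl))) v∈cs)))
    edge-covered {u} {v} a (node r cs) (elim _ es _ sep) uv (below u∈cs) v∈ =
      at-child (λ B → u ∈ₛ B × v ∈ₛ B) (edge-covered* (a ++ [ r ]) cs es uv (with-partner v∈))
      where
        with-partner : v ∈ a ⊎ v ∈T node r cs →
                       Any (λ c → u ∈T c × (v ∈ a ++ [ r ] ⊎ v ∈T c)) cs
        with-partner (inj₁ v∈a)           = Any.map (λ u∈c → u∈c , inj₁ (∈-++⁺ˡ v∈a)) u∈cs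
        with-partner (inj₂ root)          = Any.map (λ u∈c → u∈c , inj₁ (∈-++⁺ʳ a (here refl))) u∈cs
        with-partner (inj₂ (below v∈cs)) =
          Any.map (map₂ inj₂) (adjacent-same-child sep uv u∈cs v∈cs)

    edge-covered* : ∀ {u v} a cs → All (IsElim G) cs → Adj G u v →
                    Any (λ c → u ∈T c × (v ∈ a ⊎ v ∈T c)) cs →
                    Any (λ c → Σ (Pos (branchTD a c)) λ p → u ∈bag p × v ∈bag p) cs
    edge-covered* a (c ∷ cs) (e ∷ es) uv (here (u∈c , v∈)) = here (edge-covered a c e uv u∈c v∈)
    edge-covered* a (c ∷ cs) (e ∷ es) uv (there h)         = there (edge-covered* a cs es uv h)

  mutual
    branch-unique : ∀ {t L} → IsElim G t → RootLeaf t L → Unique L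
    branch-unique _                leaf     = [] ∷ []
    branch-unique (elim _ es r∉ _) (down h) = branch-unique* es r∉ h

    branch-unique* : ∀ {r cs L} → All (IsElim G) cs → All (λ c → ¬ (r ∈T c)) cs →
                     Any (λ c → RootLeaf c L) cs → Unique (r ∷ L)
    branch-unique* (e ∷ _) (r∉c ∷ _) (here rl) =
      All.tabulate (λ x∈L r≡x → r∉c (subst (_∈T _) (≡-sym r≡x) (∈-branch⇒∈T rl x∈L)))
      ∷ branch-unique e rl
    branch-unique* (_ ∷ es) (_ ∷ r∉cs) (there h) = branch-unique* es r∉cs h

  branchTD-IsTD : ∀ {t} → ElimTreeOf G t → IsTD G (branchTD [] t)
  branchTD-IsTD {t} (t-elim , t-spans) =
    (λ u v uv → edge-covered [] t t-elim uv (t-spans u) (inj₂ (t-spans v))) ,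
    (λ v → vertex-covered [] t (t-spans v)) ,
    (λ v p q → bags-connected [] t t-elim p q)

  branchTD-matched : ∀ {t} → IsElim G t → MatchedElim G t →
                     (p : Pos (branchTD [] t)) → MatchedBag G (label p)
  branchTD-matched {t} t-elim t-matched p with bag-branch [] t p
  ... | L , bag≡ , rl =
    subst (MatchedBag G) (≡-sym bag≡)
          (fromList-matched G (branch-unique t-elim rl) (t-matched L rl))

branchTD-bag≤depth : ∀ {n} (t : Tree (Fin n)) (p : Pos (branchTD [] t)) → ∣ label p ∣ ≤ depth t
branchTD-bag≤depth t p with bag-branch [] t p
... | L , bag≡ , rl =
  subst (λ B → ∣ B ∣ ≤ depth t) (≡-sym bag≡) (≤-trans (∣fromList∣≤length L) (length≤depth rl))

proposition3 : ∀ {n} (G : Graph n) → ConnectedGraph G →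
    ∀ d → IsMTD G d → MTW≤ G (d + 1)
proposition3 G _ d ((t , t-elimTree , t-matched , refl) , _) =
  branchTD [] t ,
  (branchTD-IsTD G t-elimTree , branchTD-matched G (proj₁ t-elimTree) t-matched) ,
  (begin
    maxBag (branchTD [] t) ∸ 1 ≤⟨ m∸n≤m (maxBag (branchTD [] t)) 1 ⟩
    maxBag (branchTD [] t)     ≤⟨ maxBag≤ (branchTD [] t) (branchTD-bag≤depth t) ⟩
    depth t                    ≤⟨ m≤m+n (depth t) 1 ⟩
    depth t + 1                ∎)
  where open ≤-Reasoning
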